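{- Let $L$ be a Lie ring, $K\le H\le L$ subrings, and $j\ge 0$ an integer such that $C_L(K^i)=C_L(H^i)$ for all $0\le i<j$. Then $C_L^j(K)=C_L^j(H)$.
   Context: $H^0=H$, $H^1=[H,H]$, $H^{n+1}=[H,H^n]$ (additive subgroups generated by brackets), similarly for $K$. $C_L(X)=\{y:[y,x]=0\ \forall x\in X\}$; $N_L(X)=\{x:[x,X]\subseteq X\}$. Iterated centralizers: $C_L^0(H)=\{0\}$, $C_L^{n+1}(H)=\{x\in \bigcap_{1\le i\le n}N_L(C_L^i(H)) : [x,H]\subseteq C_L^n(H)\}$. -}

module Defs where

open import Level using (Level; _⊔_) renaming (suc to lsuc)
open import Data.Nat using (ℕ; zero; suc)
open import Data.Product using (_×_; ∃-syntax; _,_)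
open import Data.Unit.Polymorphic using (⊤)
open import Relation.Unary using (Pred; _∈_; _⊆_)
open import Relation.Binary.PropositionalEquality using (_≡_)
open import Algebra.Structures using (IsAbelianGroup)

record LieRing (c : Level) : Set (lsuc c) where
  infixl 6 _+_
  field
    Carrier   : Set c
    _+_       : Carrier → Carrier → Carrier
    0#        : Carrier
    -_        : Carrier → Carrier
    [_,_]     : Carrier → Carrier → Carrier
    isAbelianGroup : IsAbelianGroup _≡_ _+_ 0# -_
    bracket-addˡ : ∀ x y z → [ x + y , z ] ≡ [ x , z ] + [ y , z ]
    bracket-addʳ : ∀ x y z → [ x , y + z ] ≡ [ x , y ] + [ x , z ]
    bracket-alt  : ∀ x → [ x , x ] ≡ 0#
    jacobi       : ∀ x y z → [ x , [ y , z ] ] + [ y , [ z , x ] ] + [ z , [ x , y ] ] ≡ 0#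

module _ {c : Level} (L : LieRing c) where
  open LieRing L

  record IsSubring {ℓ : Level} (H : Pred Carrier ℓ) : Set (c ⊔ ℓ) where
    field
      0∈  : 0# ∈ H
      +∈  : ∀ {x y} → x ∈ H → y ∈ H → (x + y) ∈ H
      -∈  : ∀ {x} → x ∈ H → (- x) ∈ H
      []∈ : ∀ {x y} → x ∈ H → y ∈ H → [ x , y ] ∈ H

  data Gen {ℓ : Level} (S : Pred Carrier ℓ) : Pred Carrier (c ⊔ ℓ) where
    gen-inc  : ∀ {x} → S x → Gen S x
    gen-zero : Gen S 0#
    gen-add  : ∀ {x y} → Gen S x → Gen S y → Gen S (x + y)
    gen-neg  : ∀ {x} → Gen S x → Gen S (- x)

  Brackets : ∀ {ℓ₁ ℓ₂} → Pred Carrier ℓ₁ → Pred Carrier ℓ₂ → Pred Carrier (c ⊔ ℓ₁ ⊔ ℓ₂)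
  Brackets A B x = ∃[ a ] ∃[ b ] (A a × B b × x ≡ [ a , b ])

  Bracket : ∀ {ℓ₁ ℓ₂} → Pred Carrier ℓ₁ → Pred Carrier ℓ₂ → Pred Carrier (c ⊔ ℓ₁ ⊔ ℓ₂)
  Bracket A B = Gen (Brackets A B)

  Pow : ∀ {ℓ} → Pred Carrier ℓ → ℕ → Pred Carrier (c ⊔ ℓ)
  Pow {ℓ} H zero    x = Level.Lift (c ⊔ ℓ) (H x)
  Pow H (suc n) = Bracket H (Pow H n)

  Cent : ∀ {ℓ} → Pred Carrier ℓ → Pred Carrier (c ⊔ ℓ)
  Cent X y = ∀ x → X x → [ y , x ] ≡ 0#

  Norm : ∀ {ℓ} → Pred Carrier ℓ → Pred Carrier (c ⊔ ℓ)
  Norm X x = ∀ y → X y → X [ x , y ]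

  -- iterated centralizers C_L^n(H), together with
  -- NormUpTo H n = ⋂_{1 ≤ i ≤ n} N_L(C_L^i(H))
  mutual
    IterCent : ∀ {ℓ} → Pred Carrier ℓ → ℕ → Pred Carrier (c ⊔ ℓ)
    IterCent {ℓ} H zero    x = Level.Lift (c ⊔ ℓ) (x ≡ 0#)
    IterCent H (suc n) x = NormUpTo H n x × (∀ h → H h → IterCent H n [ x , h ])

    NormUpTo : ∀ {ℓ} → Pred Carrier ℓ → ℕ → Pred Carrier (c ⊔ ℓ)
    NormUpTo H zero    x = ⊤
    NormUpTo H (suc n) x = NormUpTo H n x × Norm (IterCent H (suc n)) x

-- The normalizer conditions defining C^{j+1} only involve C^{≤j}, where K and H
-- agree by induction, and K ⊆ H gives C^{j+1}(H) ⊆ C^{j+1}(K).  Conversely, for x ∈ C^{j+1}(K)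
-- one shows [x, H^b] ⊆ C^t(K) whenever b + t = j, by induction on t.  For t = 0 this is the
-- hypothesis C(K^j) = C(H^j), as x centralizes K^j.  For t + 1, H normalizes C^i(H) = C^i(K), and
-- the Jacobi identity reduces [[x,y],k] (y ∈ H^b, k ∈ K) to [x,[k,y]] with [k,y] ∈ H^{b+1}, and to
-- [y,[x,k]] where [x,k] ∈ C^j(K) = C^j(H) is mapped into C^t(H) = C^t(K) by H^b.
module Submission where

open import Defs
open import Level using (Level; _⊔_; lift; lower)
open import Algebra.Bundles using (Group)
open import Algebra.Structures using (IsAbelianGroup)
import Algebra.Properties.Group as GroupProperties
open import Data.Nat as ℕ using (ℕ; zero; suc; _<_; _≤′_; ≤′-refl; ≤′-step)
open import Data.Nat.Properties using (+-suc; +-identityʳ; n<1+n; m<n⇒m<1+n; ≤′-trans; n≤′m+n)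
open import Data.Product using (_,_; proj₁; proj₂)
open import Data.Unit.Polymorphic using (tt)
open import Relation.Unary using (Pred; _∈_; _⊆_; _≐_; _∩_)
open import Relation.Unary.Properties using (≐-refl; ≐-sym)
open import Relation.Binary.PropositionalEquality
  using (_≡_; refl; sym; trans; cong; cong₂; subst; module ≡-Reasoning)

module _ {c : Level} (L : LieRing c) where
  open LieRing L
  open IsAbelianGroup isAbelianGroup using (assoc; identityˡ; identityʳ; inverseˡ; inverseʳ; isGroup)
  open ≡-Reasoning

  +-group : Group c c
  +-group = record
    { Carrier = Carrier ; _≈_ = _≡_ ; _∙_ = _+_ ; ε = 0# ; _⁻¹ = -_ ; isGroup = isGroup }

  open GroupProperties +-group
    using (identityʳ-unique; inverseˡ-unique; inverseʳ-unique; ⁻¹-involutive; ε⁻¹≈ε)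

  bracket-zeroʳ : ∀ x → [ x , 0# ] ≡ 0#
  bracket-zeroʳ x = identityʳ-unique _ _
    (trans (sym (bracket-addʳ x 0# 0#)) (cong [ x ,_] (identityʳ 0#)))

  bracket-zeroˡ : ∀ x → [ 0# , x ] ≡ 0#
  bracket-zeroˡ x = identityʳ-unique _ _
    (trans (sym (bracket-addˡ 0# 0# x)) (cong [_, x ] (identityʳ 0#)))

  bracket-negʳ : ∀ x y → [ x , - y ] ≡ - [ x , y ]
  bracket-negʳ x y = inverseʳ-unique _ _ (begin
    [ x , y ] + [ x , - y ]  ≡⟨ bracket-addʳ x y (- y) ⟨
    [ x , y + - y ]          ≡⟨ cong [ x ,_] (inverseʳ y) ⟩
    [ x , 0# ]               ≡⟨ bracket-zeroʳ x ⟩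
    0#                       ∎)

  bracket-negˡ : ∀ x y → [ - x , y ] ≡ - [ x , y ]
  bracket-negˡ x y = inverseʳ-unique _ _ (begin
    [ x , y ] + [ - x , y ]  ≡⟨ bracket-addˡ x (- x) y ⟨
    [ x + - x , y ]          ≡⟨ cong [_, y ] (inverseʳ x) ⟩
    [ 0# , y ]               ≡⟨ bracket-zeroˡ y ⟩
    0#                       ∎)

  bracket-antisym : ∀ x y → [ y , x ] ≡ - [ x , y ]
  bracket-antisym x y = inverseʳ-unique _ _ (begin
    [ x , y ] + [ y , x ]                              ≡⟨ cong₂ _+_ (identityˡ _) (identityʳ _) ⟨
    (0# + [ x , y ]) + ([ y , x ] + 0#)                ≡⟨ cong₂ (λ u v → (u + [ x , y ]) + ([ y , x ] + v))
                                                                (bracket-alt x) (bracket-alt y) ⟨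
    ([ x , x ] + [ x , y ]) + ([ y , x ] + [ y , y ])  ≡⟨ cong₂ _+_ (bracket-addʳ x x y) (bracket-addʳ y x y) ⟨
    [ x , x + y ] + [ y , x + y ]                      ≡⟨ bracket-addˡ x y (x + y) ⟨
    [ x + y , x + y ]                                  ≡⟨ bracket-alt (x + y) ⟩
    0#                                                 ∎)

  ad-commutator : ∀ x y z → [ [ x , y ] , z ] ≡ [ x , [ y , z ] ] + - [ y , [ x , z ] ]
  ad-commutator x y z = sym (begin
    [ x , [ y , z ] ] + - [ y , [ x , z ] ]  ≡⟨ inverseˡ-unique _ _ jacobi′ ⟩
    - - [ [ x , y ] , z ]                    ≡⟨ ⁻¹-involutive _ ⟩
    [ [ x , y ] , z ]                        ∎)
    where
    jacobi′ : [ x , [ y , z ] ] + - [ y , [ x , z ] ] + - [ [ x , y ] , z ] ≡ 0#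
    jacobi′ = begin
      [ x , [ y , z ] ] + - [ y , [ x , z ] ] + - [ [ x , y ] , z ]
        ≡⟨ cong₂ (λ u v → [ x , [ y , z ] ] + u + v)
                 (trans (cong [ y ,_] (bracket-antisym x z)) (bracket-negʳ y [ x , z ]))
                 (bracket-antisym [ x , y ] z) ⟨
      [ x , [ y , z ] ] + [ y , [ z , x ] ] + [ z , [ x , y ] ]
        ≡⟨ jacobi x y z ⟩
      0# ∎

  ad-derivation : ∀ x y z → [ x , [ y , z ] ] ≡ [ [ x , y ] , z ] + [ y , [ x , z ] ]
  ad-derivation x y z = begin
    [ x , [ y , z ] ]                                            ≡⟨ identityʳ _ ⟨
    [ x , [ y , z ] ] + 0#                                       ≡⟨ cong ([ x , [ y , z ] ] +_) (inverseˡ _) ⟨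
    [ x , [ y , z ] ] + (- [ y , [ x , z ] ] + [ y , [ x , z ] ]) ≡⟨ assoc _ _ _ ⟨
    [ x , [ y , z ] ] + - [ y , [ x , z ] ] + [ y , [ x , z ] ]   ≡⟨ cong (_+ [ y , [ x , z ] ]) (ad-commutator x y z) ⟨
    [ [ x , y ] , z ] + [ y , [ x , z ] ]                        ∎

  record IsAdditiveSubgroup {ℓ} (X : Pred Carrier ℓ) : Set (c ⊔ ℓ) where
    field
      0∈ : 0# ∈ X
      +∈ : ∀ {x y} → x ∈ X → y ∈ X → x + y ∈ X
      -∈ : ∀ {x} → x ∈ X → - x ∈ X

  BracketsInto : ∀ {ℓ₁ ℓ₂} → Pred Carrier ℓ₁ → Pred Carrier ℓ₂ → Pred Carrier (c ⊔ ℓ₁ ⊔ ℓ₂)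
  BracketsInto A X x = ∀ a → a ∈ A → [ x , a ] ∈ X

  _^_ : ∀ {ℓ} → Pred Carrier ℓ → ℕ → Pred Carrier (c ⊔ ℓ)
  H ^ n = Pow L H n

  C[_]^_ : ∀ {ℓ} → Pred Carrier ℓ → ℕ → Pred Carrier (c ⊔ ℓ)
  C[ H ]^ n = IterCent L H n

  Norm-resp-≐ : ∀ {ℓ₁ ℓ₂} {X : Pred Carrier ℓ₁} {Y : Pred Carrier ℓ₂} → X ≐ Y → Norm L X ⊆ Norm L Y
  Norm-resp-≐ (X⊆Y , Y⊆X) x-norm y y∈Y = X⊆Y (x-norm y (Y⊆X y∈Y))

  ∩-isAdditiveSubgroup : ∀ {ℓ₁ ℓ₂} {X : Pred Carrier ℓ₁} {Y : Pred Carrier ℓ₂} →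
                         IsAdditiveSubgroup X → IsAdditiveSubgroup Y → IsAdditiveSubgroup (X ∩ Y)
  ∩-isAdditiveSubgroup X-add Y-add = record
    { 0∈ = X.0∈ , Y.0∈
    ; +∈ = λ (x∈X , x∈Y) (y∈X , y∈Y) → X.+∈ x∈X y∈X , Y.+∈ x∈Y y∈Y
    ; -∈ = λ (x∈X , x∈Y) → X.-∈ x∈X , Y.-∈ x∈Y
    }
    where
    module X = IsAdditiveSubgroup X-add
    module Y = IsAdditiveSubgroup Y-add

  module _ {ℓ} {X : Pred Carrier ℓ} (X-additive : IsAdditiveSubgroup X) where
    open IsAdditiveSubgroup X-additive

    bracket-swap-∈ : ∀ {x y} → [ x , y ] ∈ X → [ y , x ] ∈ X
    bracket-swap-∈ {x} {y} p = subst X (sym (bracket-antisym x y)) (-∈ p)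

    bracket-swapʳ-∈ : ∀ {x y z} → [ x , [ y , z ] ] ∈ X → [ x , [ z , y ] ] ∈ X
    bracket-swapʳ-∈ {x} {y} {z} p =
      subst X (sym (trans (cong [ x ,_] (bracket-antisym y z)) (bracket-negʳ x [ y , z ]))) (-∈ p)

    ad-commutator-∈ : ∀ {x y z} → [ x , [ y , z ] ] ∈ X → [ y , [ x , z ] ] ∈ X → [ [ x , y ] , z ] ∈ X
    ad-commutator-∈ {x} {y} {z} p q = subst X (sym (ad-commutator x y z)) (+∈ p (-∈ q))

    ad-derivation-∈ : ∀ {x y z} → [ [ x , y ] , z ] ∈ X → [ y , [ x , z ] ] ∈ X → [ x , [ y , z ] ] ∈ X
    ad-derivation-∈ {x} {y} {z} p q = subst X (sym (ad-derivation x y z)) (+∈ p q)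

    Gen-least : ∀ {ℓ′} {S : Pred Carrier ℓ′} → S ⊆ X → Gen L S ⊆ X
    Gen-least S⊆X (gen-inc s) = S⊆X s
    Gen-least S⊆X gen-zero    = 0∈
    Gen-least S⊆X (gen-add p q) = +∈ (Gen-least S⊆X p) (Gen-least S⊆X q)
    Gen-least S⊆X (gen-neg p) = -∈ (Gen-least S⊆X p)

    BracketsInto-Gen : ∀ {ℓ′} {S : Pred Carrier ℓ′} {x} → BracketsInto S X x → BracketsInto (Gen L S) X x
    BracketsInto-Gen x-br _ (gen-inc s) = x-br _ s
    BracketsInto-Gen {x = x} x-br _ gen-zero =
      subst X (sym (bracket-zeroʳ x)) 0∈
    BracketsInto-Gen {x = x} x-br _ (gen-add {a} {b} p q) =
      subst X (sym (bracket-addʳ x a b)) (+∈ (BracketsInto-Gen x-br _ p) (BracketsInto-Gen x-br _ q))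
    BracketsInto-Gen {x = x} x-br _ (gen-neg {a} p) =
      subst X (sym (bracket-negʳ x a)) (-∈ (BracketsInto-Gen x-br _ p))

    BracketsInto-isAdditiveSubgroup : ∀ {ℓ′} (A : Pred Carrier ℓ′) → IsAdditiveSubgroup (BracketsInto A X)
    BracketsInto-isAdditiveSubgroup A = record
      { 0∈ = λ a _ → subst X (sym (bracket-zeroˡ a)) 0∈
      ; +∈ = λ {x} {y} x-br y-br a a∈ → subst X (sym (bracket-addˡ x y a)) (+∈ (x-br a a∈) (y-br a a∈))
      ; -∈ = λ {x} x-br a a∈ → subst X (sym (bracket-negˡ x a)) (-∈ (x-br a a∈))
      }

    Norm-bracket : ∀ {x y} → Norm L X x → Norm L X y → Norm L X [ x , y ]
    Norm-bracket x-norm y-norm z z∈ = ad-commutator-∈ (x-norm _ (y-norm z z∈)) (y-norm _ (x-norm z z∈))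

  Pow⊆ : ∀ {ℓ} {H : Pred Carrier ℓ} → IsSubring L H → ∀ n → H ^ n ⊆ H
  Pow⊆ H-subring zero (lift h∈) = h∈
  Pow⊆ {H = H} H-subring (suc n) = Gen-least H-additive brackets⊆
    where
    open IsSubring H-subring
    H-additive : IsAdditiveSubgroup H
    H-additive = record { 0∈ = 0∈ ; +∈ = +∈ ; -∈ = -∈ }
    brackets⊆ : Brackets L H (H ^ n) ⊆ H
    brackets⊆ (_ , _ , h∈ , y∈ , refl) = []∈ h∈ (Pow⊆ H-subring n y∈)

  module IteratedCentralizer {ℓ} (H : Pred Carrier ℓ) where
    open IsAdditiveSubgroup

    mutual
      IterCent-isAdditiveSubgroup : ∀ n → IsAdditiveSubgroup (C[ H ]^ n)
      IterCent-isAdditiveSubgroup zero .0∈ = lift refl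
      IterCent-isAdditiveSubgroup zero .+∈ (lift x≡0) (lift y≡0) =
        lift (trans (cong₂ _+_ x≡0 y≡0) (identityʳ 0#))
      IterCent-isAdditiveSubgroup zero .-∈ (lift x≡0) = lift (trans (cong -_ x≡0) ε⁻¹≈ε)
      IterCent-isAdditiveSubgroup (suc n) = ∩-isAdditiveSubgroup
        (NormUpTo-isAdditiveSubgroup n)
        (BracketsInto-isAdditiveSubgroup (IterCent-isAdditiveSubgroup n) H)

      NormUpTo-isAdditiveSubgroup : ∀ n → IsAdditiveSubgroup (NormUpTo L H n)
      NormUpTo-isAdditiveSubgroup zero = record { 0∈ = tt ; +∈ = λ _ _ → tt ; -∈ = λ _ → tt }
      NormUpTo-isAdditiveSubgroup (suc n) = ∩-isAdditiveSubgroup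
        (NormUpTo-isAdditiveSubgroup n)
        (BracketsInto-isAdditiveSubgroup (IterCent-isAdditiveSubgroup (suc n)) (C[ H ]^ suc n))

    NormUpTo⇒Norm : ∀ {n x} → NormUpTo L H n x → ∀ {i} → i ≤′ n → Norm L (C[ H ]^ i) x
    NormUpTo⇒Norm {zero} {x} _ ≤′-refl _ (lift y≡0) = lift (trans (cong [ x ,_] y≡0) (bracket-zeroʳ x))
    NormUpTo⇒Norm {suc n} (_ , x-norm) ≤′-refl = x-norm
    NormUpTo⇒Norm {suc n} (x-norms , _) (≤′-step i≤′n) = NormUpTo⇒Norm x-norms i≤′n

    Norm⇒NormUpTo : ∀ n {x} → (∀ {i} → i ≤′ n → Norm L (C[ H ]^ i) x) → NormUpTo L H n x
    Norm⇒NormUpTo zero    _       = tt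
    Norm⇒NormUpTo (suc n) x-norms = Norm⇒NormUpTo n (λ i≤′n → x-norms (≤′-step i≤′n)) , x-norms ≤′-refl

    IterCent⇒Norm : ∀ {n x} → x ∈ C[ H ]^ suc n → Norm L (C[ H ]^ n) x
    IterCent⇒Norm (x-norms , _) = NormUpTo⇒Norm x-norms ≤′-refl

    IterCent-zero-bracket : ∀ {x} y → x ∈ C[ H ]^ zero → [ x , y ] ∈ C[ H ]^ zero
    IterCent-zero-bracket y (lift x≡0) = lift (trans (cong [_, y ] x≡0) (bracket-zeroˡ y))

    IterCent-bracket : ∀ n {x y} → x ∈ C[ H ]^ n → y ∈ C[ H ]^ n → [ x , y ] ∈ C[ H ]^ n
    IterCent-bracket zero x∈ _ = IterCent-zero-bracket _ x∈
    IterCent-bracket (suc n) x∈@(x-norms , x-br) y∈@(y-norms , y-br) =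
      Norm⇒NormUpTo n (λ i≤′n → Norm-bracket (IterCent-isAdditiveSubgroup _)
                                  (NormUpTo⇒Norm x-norms i≤′n) (NormUpTo⇒Norm y-norms i≤′n)) ,
      λ h h∈ → ad-commutator-∈ (IterCent-isAdditiveSubgroup n)
                 (IterCent⇒Norm x∈ _ (y-br h h∈)) (IterCent⇒Norm y∈ _ (x-br h h∈))

    IterCent-suc : ∀ n → C[ H ]^ n ⊆ C[ H ]^ suc n
    IterCent-suc zero x∈ = tt , λ h _ → IterCent-zero-bracket h x∈
    IterCent-suc (suc n) x∈@(x-norms , x-br) =
      (x-norms , λ _ → IterCent-bracket (suc n) x∈) , λ h h∈ → IterCent-suc n (x-br h h∈)

    H-normalizes : ∀ {h} → h ∈ H → ∀ n → Norm L (C[ H ]^ n) h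
    H-normalizes {h} h∈ n x x∈ = bracket-swap-∈ (IterCent-isAdditiveSubgroup n) (bracket-H n x∈)
      where
      bracket-H : ∀ n {x} → x ∈ C[ H ]^ n → [ x , h ] ∈ C[ H ]^ n
      bracket-H zero    x∈          = IterCent-zero-bracket h x∈
      bracket-H (suc n) (_ , x-br) = IterCent-suc n (x-br h h∈)

    IterCent-bracket-Pow : ∀ b a {x} → x ∈ C[ H ]^ suc (b ℕ.+ a) → BracketsInto (H ^ b) (C[ H ]^ a) x
    IterCent-bracket-Pow zero    a (_ , x-br) y (lift y∈) = x-br y y∈
    IterCent-bracket-Pow (suc b) a {x} x∈@(_ , x-br) =
      BracketsInto-Gen (IterCent-isAdditiveSubgroup a) on-generators
      where
      x∈′ : x ∈ C[ H ]^ suc (b ℕ.+ suc a)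
      x∈′ = subst (λ n → x ∈ C[ H ]^ suc n) (sym (+-suc b a)) x∈
      on-generators : BracketsInto (Brackets L H (H ^ b)) (C[ H ]^ a) x
      on-generators _ (h , z , h∈ , z∈ , refl) = ad-derivation-∈ (IterCent-isAdditiveSubgroup a)
        (IterCent-bracket-Pow b a (x-br h h∈) z z∈)
        (bracket-swap-∈ (IterCent-isAdditiveSubgroup a) (proj₂ (IterCent-bracket-Pow b (suc a) x∈′ z z∈) h h∈))

    IterCent⊆Cent-Pow : ∀ n → C[ H ]^ suc n ⊆ Cent L (H ^ n)
    IterCent⊆Cent-Pow n {x} x∈ y y∈ =
      lower (IterCent-bracket-Pow n zero (subst (λ m → x ∈ C[ H ]^ suc m) (sym (+-identityʳ n)) x∈) y y∈)

  NormUpTo-resp-≐ : ∀ {ℓ} {A B : Pred Carrier ℓ} {n} → (∀ {i} → i ≤′ n → C[ A ]^ i ≐ C[ B ]^ i) →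
                    NormUpTo L A n ⊆ NormUpTo L B n
  NormUpTo-resp-≐ {n = zero}  _     _               = tt
  NormUpTo-resp-≐ {n = suc n} agree (x-norms , x-norm) =
    NormUpTo-resp-≐ (λ i≤′n → agree (≤′-step i≤′n)) x-norms , Norm-resp-≐ (agree ≤′-refl) x-norm

  module Agreement {ℓ} {K H : Pred Carrier ℓ} (H-subring : IsSubring L H) (K⊆H : K ⊆ H) (j : ℕ)
                   (cent : Cent L (K ^ j) ⊆ Cent L (H ^ j))
                   (agree : ∀ {i} → i ≤′ j → C[ K ]^ i ≐ C[ H ]^ i) where
    module CK = IteratedCentralizer K
    module CH = IteratedCentralizer H

    H-normalizes-C[K] : ∀ {h} → h ∈ H → ∀ {i} → i ≤′ j → Norm L (C[ K ]^ i) h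
    H-normalizes-C[K] h∈ {i} i≤′j = Norm-resp-≐ (≐-sym (agree i≤′j)) (CH.H-normalizes h∈ i)

    bracket-Pow : ∀ {x} → x ∈ C[ K ]^ suc j → ∀ t b {y} → b ℕ.+ t ≡ j → y ∈ H ^ b → [ x , y ] ∈ C[ K ]^ t
    bracket-Pow x∈ zero b {y} b+0≡j y∈ =
      lift (cent (CK.IterCent⊆Cent-Pow j x∈) y (subst (λ n → y ∈ H ^ n) (trans (sym (+-identityʳ b)) b+0≡j) y∈))
    bracket-Pow {x} x∈@(x-norms , x-br) (suc t) b {y} b+1+t≡j y∈ =
      CK.Norm⇒NormUpTo t [x,y]-normalizes , [x,y]-bracket
      where
      t≤′j : t ≤′ j
      t≤′j = ≤′-trans (≤′-step ≤′-refl) (subst (suc t ≤′_) b+1+t≡j (n≤′m+n b (suc t)))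

      [x,y]-normalizes : ∀ {i} → i ≤′ t → Norm L (C[ K ]^ i) [ x , y ]
      [x,y]-normalizes i≤′t = Norm-bracket (CK.IterCent-isAdditiveSubgroup _)
        (CK.NormUpTo⇒Norm x-norms i≤′j) (H-normalizes-C[K] (Pow⊆ H-subring b y∈) i≤′j)
        where i≤′j = ≤′-trans i≤′t t≤′j

      [x,y]-bracket : BracketsInto K (C[ K ]^ t) [ x , y ]
      [x,y]-bracket k k∈ = ad-commutator-∈ C[K]^t-additive
        (bracket-swapʳ-∈ C[K]^t-additive x[k,y]∈) (bracket-swap-∈ C[K]^t-additive [[x,k],y]∈)
        where
        C[K]^t-additive = CK.IterCent-isAdditiveSubgroup t
        x[k,y]∈ : [ x , [ k , y ] ] ∈ C[ K ]^ t
        x[k,y]∈ = bracket-Pow x∈ t (suc b) (trans (sym (+-suc b t)) b+1+t≡j)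
                    (gen-inc (k , y , K⊆H k∈ , y∈ , refl))
        [x,k]∈ : [ x , k ] ∈ C[ H ]^ suc (b ℕ.+ t)
        [x,k]∈ = subst (λ n → [ x , k ] ∈ C[ H ]^ n) (trans (sym b+1+t≡j) (+-suc b t))
                   (proj₁ (agree ≤′-refl) (x-br k k∈))
        [[x,k],y]∈ : [ [ x , k ] , y ] ∈ C[ K ]^ t
        [[x,k],y]∈ = proj₂ (agree t≤′j) (CH.IterCent-bracket-Pow b t [x,k]∈ y y∈)

    IterCent-≐-suc : C[ K ]^ suc j ≐ C[ H ]^ suc j
    IterCent-≐-suc =
      (λ x∈@(x-norms , _) → NormUpTo-resp-≐ agree x-norms ,
                            λ h h∈ → proj₁ (agree ≤′-refl) (bracket-Pow x∈ j zero refl (lift h∈))) ,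
      (λ (x-norms , x-br) → NormUpTo-resp-≐ (λ i≤′j → ≐-sym (agree i≤′j)) x-norms ,
                            λ k k∈ → proj₂ (agree ≤′-refl) (x-br k (K⊆H k∈)))

  IterCent-agree : ∀ {ℓ} {K H : Pred Carrier ℓ} → IsSubring L H → K ⊆ H → ∀ j →
                   (∀ i → i < j → Cent L (K ^ i) ≐ Cent L (H ^ i)) →
                   ∀ {i} → i ≤′ j → C[ K ]^ i ≐ C[ H ]^ i
  IterCent-agree _ _ zero _ ≤′-refl = ≐-refl
  IterCent-agree {K = K} {H} H-subring K⊆H (suc j) cents = agree-suc
    where
    agree : ∀ {i} → i ≤′ j → C[ K ]^ i ≐ C[ H ]^ i
    agree = IterCent-agree H-subring K⊆H j (λ i i<j → cents i (m<n⇒m<1+n i<j))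
    agree-suc : ∀ {i} → i ≤′ suc j → C[ K ]^ i ≐ C[ H ]^ i
    agree-suc ≤′-refl        = Agreement.IterCent-≐-suc H-subring K⊆H j (proj₁ (cents j (n<1+n j))) agree
    agree-suc (≤′-step i≤′j) = agree i≤′j

-- Only H needs to be a subring.
mainTheorem6 : {c ℓ : Level} (L : LieRing c) (K H : Pred (LieRing.Carrier L) ℓ) →
    IsSubring L K → IsSubring L H → K ⊆ H → (j : ℕ) →
    (∀ i → i < j → Cent L (Pow L K i) ≐ Cent L (Pow L H i)) →
    IterCent L K j ≐ IterCent L H j
mainTheorem6 L K H _ H-subring K⊆H j cents = IterCent-agree L H-subring K⊆H j cents ≤′-refl
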